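{- Let $n \geq 4$ be an even integer, let $W_n$ be the wheel graph on $n$ vertices with vertices labelled as described in the context, let $D$ be its distance matrix, and let $\widetilde{L}$ be the special Laplacian of $W_n$. Define $w \in \mathbb{R}^n$ by $w := \frac{1}{4}(5-n, 1, \dotsc, 1)'$. Then $D$ is invertible and \[ D^{ -1} = -\frac{1}{2}\widetilde{L} + \frac{4}{n-1} w w'. \]
   Context: The wheel graph $W_n$ ($n\ge 4$) consists of a cycle $C_{n-1}$ on $n-1$ vertices together with one additional vertex (the hub) adjacent to all vertices of the cycle. Label the hub $1$ and the cycle vertices $2,3,\dotsc,n$ in cyclic order around the cycle. The distance $d_{ij}$ is the length of a shortest path between vertices $i$ and $j$, and the distance matrix is $D=[d_{ij}]$ (zero diagonal). For $c=(c_1,\dotsc,c_m)$, $\mathrm{Circ}(c)$ denotes the $m\times m$ circulant matrix whose first row is $(c_1,\dotsc,c_m)$ and whose $k$-th row is the first row cyclically shifted $k-1$ places to the right, i.e. its $(i,j)$ entry is $c_{((j-i) \bmod m)+1}$. With this labelling, $D=\begin{bmatrix}0 & \mathbf{1}'\\ \mathbf{1} & \mathrm{Circ}(0,1,2,\dotsc,2,1)\end{bmatrix}$ where the circulant is $(n-1)\times(n-1)$. Special Laplacian: for $n\ge4$ even and $k\in\{1,\dotsc,\frac n2-1\}$, let $c^k\in\mathbb{R}^{n-1}$ have $c^k_j=1$ if $j=k+1$ or $j=n-k$ and $c^k_j=0$ otherwise, and let $C_k=\mathrm{Circ}(c^k)$ (of order $n-1$). Then \[\widetilde{L} := \frac{n-1}{2}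 I - \frac12\begin{bmatrix}0 & \mathbf{1}'\\ \mathbf{1} & 0\end{bmatrix} + \sum_{k=1}^{\frac n2 -1} (-1)^k \frac{(n-1)-2k}{2}\begin{bmatrix}0&0\\0&C_k\end{bmatrix},\] an $n\times n$ matrix; $\mathbf{1}$ denotes the all-ones vector and $I$ the identity. -}

module Defs where

open import Data.Nat as ℕ using (ℕ; zero; suc; _∸_; _≟_)
open import Data.Nat.DivMod using (_%_)
open import Data.Integer as ℤ using (ℤ; +_)
open import Data.Rational as ℚ using (ℚ; 0ℚ; 1ℚ; ½)
open import Data.Fin using (Fin; toℕ) renaming (zero to fz; suc to fs)
open import Data.List using (List; foldr; map; upTo)
open import Relation.Nullary using (yes; no)

Matrix : ℕ → Set
Matrix n = Fin n → Fin n → ℚ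

sumFin : ∀ {n} → (Fin n → ℚ) → ℚ
sumFin {zero} f = 0ℚ
sumFin {suc n} f = f fz ℚ.+ sumFin (λ k → f (fs k))

infixl 7 _⊗_
infixl 6 _⊕_
infixr 8 _·_

_⊗_ : ∀ {n} → Matrix n → Matrix n → Matrix n
(A ⊗ B) i j = sumFin (λ k → A i k ℚ.* B k j)

_⊕_ : ∀ {n} → Matrix n → Matrix n → Matrix n
(A ⊕ B) i j = A i j ℚ.+ B i j

_·_ : ∀ {n} → ℚ → Matrix n → Matrix n
(c · A) i j = c ℚ.* A i j

Id : ∀ {n} → Matrix n
Id i j with toℕ i ≟ toℕ j
... | yes _ = 1ℚ
... | no _ = 0ℚ

zeroM : ∀ {n} → Matrix n
zeroM i j = 0ℚ

sumM : ∀ {n} → List (Matrix n) → Matrix n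
sumM = foldr _⊕_ zeroM

-- Total natural-number modulus (the m = 0 case is never used).
_mod_ : ℕ → ℕ → ℕ
a mod zero = zero
a mod suc k = a % suc k

-- Total division of an integer by a natural (d = 0 case never used).
_//_ : ℤ → ℕ → ℚ
p // zero = 0ℚ
p // suc d = p ℚ./ suc d

-- Circulant matrix of order m with first row c (0-based: c 0, ..., c (m-1)):
-- its (p,q) entry (0-based) is c ((q - p) mod m).
circℕ : (m : ℕ) → (ℕ → ℚ) → ℕ → ℕ → ℚ
circℕ m c p q = c ((q ℕ.+ m ∸ p) mod m)

-- Block matrix [ corner  row' ; col  inner ] of order n, where the
-- first index (0-based index 0) is the hub and indices 1..n-1 are the
-- inner block (shifted to 0..n-2).
blockℕ : ℚ → (ℕ → ℚ) → (ℕ → ℚ) → (ℕ → ℕ → ℚ) → ℕ → ℕ → ℚ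
blockℕ corner row col inner zero zero = corner
blockℕ corner row col inner zero (suc q) = row q
blockℕ corner row col inner (suc p) zero = col p
blockℕ corner row col inner (suc p) (suc q) = inner p q

block : (n : ℕ) → ℚ → (ℕ → ℚ) → (ℕ → ℚ) → (ℕ → ℕ → ℚ) → Matrix n
block n corner row col inner i j = blockℕ corner row col inner (toℕ i) (toℕ j)

one : ℕ → ℚ
one _ = 1ℚ

zero' : ℕ → ℚ
zero' _ = 0ℚ

distRow : ℕ → ℕ → ℚ
distRow m zero = 0ℚ
distRow m (suc zero) = 1ℚ
distRow m (suc (suc j)) with suc (suc j) ≟ m ∸ 1
... | yes _ = 1ℚ
... | no _ = + 2 ℚ./ 1

-- Distance matrix of the wheel W_n: hub = index 0, cycle vertices
-- 2,...,n in cyclic order = indices 1,...,n-1.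
wheelD : (n : ℕ) → Matrix n
wheelD n = block n 0ℚ one one (circℕ (n ∸ 1) (distRow (n ∸ 1)))

-- The vector c^k (0-based): 1 at 1-based positions k+1 and n-k,
-- i.e. 0-based positions k and n-k-1; 0 elsewhere.
ck : (n k : ℕ) → ℕ → ℚ
ck n k j with j ≟ k | j ≟ n ∸ k ∸ 1
... | yes _ | _ = 1ℚ
... | no _ | yes _ = 1ℚ
... | no _ | no _ = 0ℚ

Ckblock : (n k : ℕ) → Matrix n
Ckblock n k = block n 0ℚ zero' zero' (circℕ (n ∸ 1) (ck n k))

sgn : ℕ → ℤ
sgn zero = + 1
sgn (suc k) = ℤ.- sgn k

specialL : (n : ℕ) → Matrix n
specialL n =
  ((+ (n ∸ 1) ℚ./ 2) · Id)
  ⊕ ((ℚ.- ½) · block n 0ℚ one one (λ _ _ → 0ℚ))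
  ⊕ sumM (map (λ k → ((sgn k ℤ.* + (n ∸ 1 ∸ 2 ℕ.* k)) ℚ./ 2) · Ckblock n k)
              (map suc (upTo (n ℕ./ 2 ∸ 1))))

wvec : (n : ℕ) → Fin n → ℚ
wvec n i with toℕ i
... | zero = (+ 5 ℤ.- + n) ℚ./ 4
... | suc _ = + 1 ℚ./ 4

claimedInverse : (n : ℕ) → Matrix n
claimedInverse n =
  ((ℚ.- ½) · specialL n) ⊕ (((+ 4) // (n ∸ 1)) · (λ i j → wvec n i ℚ.* wvec n j))

module Submission where

-- Put m = n − 1 = 2t + 1 and index the rim by ℤ/m.  On the rim, D is the circulant
-- 2J − 2I − A (A the adjacency matrix of the cycle), and L̃ is the circulant Circ(coeff)
-- with coeff e = (−1)^e (m − 2e)/2.  Since m is odd, coeff e = coeff (m − e); this makes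
-- L̃ symmetric and gives the three-term identity
--   2 coeff x + coeff (x − 1) + coeff (x + 1) = 2 [x = 0]   (indices mod m)
-- and Σ_e coeff e = ½.  From these, D L̃ = 2 · 1 w' − 2 I and D w = (m/4) · 1, so
-- D (−½ L̃ + (4/m) w w') = I; the other product follows because D and L̃ are symmetric.

open import Defs
open import Data.Nat using (ℕ; _≤_)
open import Data.Nat.Divisibility using (_∣_)
open import Data.Product using (_×_)
open import Relation.Binary.PropositionalEquality using (_≡_)

open import Data.Nat.Divisibility using (divides)
open import Data.Product using (Σ; _,_)

open import Data.Nat as ℕ using (zero; suc; _<_; _≟_; _≤?_; z≤n; s≤s)
import Data.Nat.Properties as ℕₚ
open import Data.Nat.DivMod using (_%_; [m+n]%n≡m%n; m<n⇒m%n≡m; m*n/n≡m)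
open import Data.Integer as ℤ using (ℤ)
import Data.Integer.Properties as ℤₚ
open import Data.Rational as ℚ using (ℚ; 0ℚ; 1ℚ; ½; toℚᵘ)
import Data.Rational.Properties as ℚₚ
import Data.Rational.Unnormalised as ℚᵘ
import Data.Rational.Unnormalised.Properties as ℚᵘₚ
open import Data.Rational.Solver using (module +-*-Solver)
open import Data.Fin as Fin using (Fin; toℕ)
open import Data.Fin.Properties using (toℕ<n)
open import Data.Empty using (⊥-elim)
open import Data.List using (map; applyUpTo; upTo)
open import Data.Sum using (_⊎_; inj₁; inj₂)
open import Relation.Nullary using (¬_; yes; no)
open import Relation.Binary.PropositionalEquality
  using (refl; sym; trans; cong; cong₂; subst; module ≡-Reasoning)

module _ where
  open import Data.Rational using (_+_; _*_; _-_; -_)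
  open +-*-Solver

  fromℤ : ℤ → ℚ
  fromℤ z = z ℚ./ 1

  fromℕ : ℕ → ℚ
  fromℕ n = fromℤ (ℤ.+ n)

  module _ where
    open ℚᵘₚ.≃-Reasoning

    private
      toℚᵘ-/ : ∀ z d → toℚᵘ (z ℚ./ suc d) ℚᵘ.≃ ℚᵘ.mkℚᵘ z d
      toℚᵘ-/ z d = ℚₚ.toℚᵘ-fromℚᵘ (ℚᵘ.mkℚᵘ z d)

      toℚᵘ-fromℤ : ∀ z → ℚᵘ.mkℚᵘ z 0 ℚᵘ.≃ toℚᵘ (fromℤ z)
      toℚᵘ-fromℤ z = ℚᵘₚ.≃-sym (toℚᵘ-/ z 0)

    fromℤ-+ : ∀ a b → fromℤ (a ℤ.+ b) ≡ fromℤ a + fromℤ b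
    fromℤ-+ a b = ℚₚ.toℚᵘ-injective (begin
      toℚᵘ (fromℤ (a ℤ.+ b))              ≈⟨ toℚᵘ-/ (a ℤ.+ b) 0 ⟩
      ℚᵘ.mkℚᵘ (a ℤ.+ b) 0                 ≈⟨ ℚᵘ.*≡* (cong (ℤ._* ℤ.+ 1) (cong₂ ℤ._+_ (sym (ℤₚ.*-identityʳ a)) (sym (ℤₚ.*-identityʳ b)))) ⟩
      ℚᵘ.mkℚᵘ a 0 ℚᵘ.+ ℚᵘ.mkℚᵘ b 0        ≈⟨ ℚᵘₚ.+-cong (toℚᵘ-fromℤ a) (toℚᵘ-fromℤ b) ⟩
      toℚᵘ (fromℤ a) ℚᵘ.+ toℚᵘ (fromℤ b)  ≈⟨ ℚᵘₚ.≃-sym (ℚₚ.toℚᵘ-homo-+ (fromℤ a) (fromℤ b)) ⟩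
      toℚᵘ (fromℤ a + fromℤ b)            ∎)

    fromℤ-* : ∀ a b → fromℤ (a ℤ.* b) ≡ fromℤ a * fromℤ b
    fromℤ-* a b = ℚₚ.toℚᵘ-injective (begin
      toℚᵘ (fromℤ (a ℤ.* b))              ≈⟨ toℚᵘ-/ (a ℤ.* b) 0 ⟩
      ℚᵘ.mkℚᵘ (a ℤ.* b) 0                 ≈⟨ ℚᵘ.*≡* refl ⟩
      ℚᵘ.mkℚᵘ a 0 ℚᵘ.* ℚᵘ.mkℚᵘ b 0        ≈⟨ ℚᵘₚ.*-cong (toℚᵘ-fromℤ a) (toℚᵘ-fromℤ b) ⟩
      toℚᵘ (fromℤ a) ℚᵘ.* toℚᵘ (fromℤ b)  ≈⟨ ℚᵘₚ.≃-sym (ℚₚ.toℚᵘ-homo-* (fromℤ a) (fromℤ b)) ⟩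
      toℚᵘ (fromℤ a * fromℤ b)            ∎)

    fromℤ-neg : ∀ a → fromℤ (ℤ.- a) ≡ - fromℤ a
    fromℤ-neg a = ℚₚ.toℚᵘ-injective (begin
      toℚᵘ (fromℤ (ℤ.- a))   ≈⟨ toℚᵘ-/ (ℤ.- a) 0 ⟩
      ℚᵘ.mkℚᵘ (ℤ.- a) 0      ≈⟨ ℚᵘ.*≡* refl ⟩
      ℚᵘ.- ℚᵘ.mkℚᵘ a 0       ≈⟨ ℚᵘₚ.-‿cong (toℚᵘ-fromℤ a) ⟩
      ℚᵘ.- toℚᵘ (fromℤ a)    ≈⟨ ℚᵘₚ.≃-sym (ℚₚ.toℚᵘ-homo‿- (fromℤ a)) ⟩
      toℚᵘ (- fromℤ a)       ∎)

    /-suc : ∀ z d → z ℚ./ suc d ≡ fromℤ z * (ℤ.+ 1 ℚ./ suc d)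
    /-suc z d = ℚₚ.toℚᵘ-injective (begin
      toℚᵘ (z ℚ./ suc d)                             ≈⟨ toℚᵘ-/ z d ⟩
      ℚᵘ.mkℚᵘ z d                                    ≈⟨ ℚᵘ.*≡* (trans (cong (λ x → z ℤ.* ℤ.+ suc x) (ℕₚ.+-identityʳ d))
                                                                      (cong (ℤ._* ℤ.+ suc d) (sym (ℤₚ.*-identityʳ z)))) ⟩
      ℚᵘ.mkℚᵘ z 0 ℚᵘ.* ℚᵘ.mkℚᵘ (ℤ.+ 1) d               ≈⟨ ℚᵘₚ.*-cong (toℚᵘ-fromℤ z) (ℚᵘₚ.≃-sym (toℚᵘ-/ (ℤ.+ 1) d)) ⟩
      toℚᵘ (fromℤ z) ℚᵘ.* toℚᵘ (ℤ.+ 1 ℚ./ suc d)       ≈⟨ ℚᵘₚ.≃-sym (ℚₚ.toℚᵘ-homo-* (fromℤ z) _) ⟩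
      toℚᵘ (fromℤ z * (ℤ.+ 1 ℚ./ suc d))               ∎)

    fromℕ-*-1/ : ∀ d → fromℕ (suc d) * (ℤ.+ 1 ℚ./ suc d) ≡ 1ℚ
    fromℕ-*-1/ d = ℚₚ.toℚᵘ-injective (begin
      toℚᵘ (fromℕ (suc d) * (ℤ.+ 1 ℚ./ suc d))              ≈⟨ ℚₚ.toℚᵘ-homo-* (fromℕ (suc d)) _ ⟩
      toℚᵘ (fromℕ (suc d)) ℚᵘ.* toℚᵘ (ℤ.+ 1 ℚ./ suc d)      ≈⟨ ℚᵘₚ.*-cong (toℚᵘ-/ (ℤ.+ suc d) 0) (toℚᵘ-/ (ℤ.+ 1) d) ⟩
      ℚᵘ.mkℚᵘ (ℤ.+ suc d) 0 ℚᵘ.* ℚᵘ.mkℚᵘ (ℤ.+ 1) d            ≈⟨ ℚᵘ.*≡* (trans (ℤₚ.*-identityʳ _) (trans (ℤₚ.*-identityʳ _)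
                                                                      (trans (cong (λ x → ℤ.+ suc x) (sym (ℕₚ.+-identityʳ d))) (sym (ℤₚ.*-identityˡ _))))) ⟩
      toℚᵘ 1ℚ                                             ∎)

  fromℕ-+ : ∀ a b → fromℕ (a ℕ.+ b) ≡ fromℕ a + fromℕ b
  fromℕ-+ a b = fromℤ-+ (ℤ.+ a) (ℤ.+ b)

  fromℕ-* : ∀ a b → fromℕ (a ℕ.* b) ≡ fromℕ a * fromℕ b
  fromℕ-* a b = trans (cong fromℤ (ℤₚ.pos-* a b)) (fromℤ-* (ℤ.+ a) (ℤ.+ b))

  fromℕ-∸ : ∀ {a b} → b ≤ a → fromℕ (a ℕ.∸ b) ≡ fromℕ a - fromℕ b
  fromℕ-∸ {a} {b} b≤a = begin
    fromℕ (a ℕ.∸ b)                        ≡⟨ solve 2 (λ x y → x := (x :+ y) :- y) refl (fromℕ (a ℕ.∸ b)) (fromℕ b) ⟩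
    (fromℕ (a ℕ.∸ b) + fromℕ b) - fromℕ b  ≡⟨ cong (_- fromℕ b) (sym (fromℕ-+ (a ℕ.∸ b) b)) ⟩
    fromℕ (a ℕ.∸ b ℕ.+ b) - fromℕ b        ≡⟨ cong (λ x → fromℕ x - fromℕ b) (ℕₚ.m∸n+n≡m b≤a) ⟩
    fromℕ a - fromℕ b                      ∎
    where open ≡-Reasoning

  sum : ℕ → (ℕ → ℚ) → ℚ
  sum zero    f = 0ℚ
  sum (suc n) f = f 0 + sum n (λ k → f (suc k))

  syntax sum n (λ k → e) = ∑[ k < n ] e

  sum-cong : ∀ n {f g : ℕ → ℚ} → (∀ k → k < n → f k ≡ g k) → sum n f ≡ sum n g
  sum-cong zero    eq = refl
  sum-cong (suc n) eq = cong₂ _+_ (eq 0 (s≤s z≤n)) (sum-cong n (λ k k<n → eq (suc k) (s≤s k<n)))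

  sum-zero : ∀ n {f : ℕ → ℚ} → (∀ k → k < n → f k ≡ 0ℚ) → sum n f ≡ 0ℚ
  sum-zero zero    eq = refl
  sum-zero (suc n) eq = cong₂ _+_ (eq 0 (s≤s z≤n)) (sum-zero n (λ k k<n → eq (suc k) (s≤s k<n)))

  ∑-distrib-+ : ∀ n (f g : ℕ → ℚ) → ∑[ k < n ] (f k + g k) ≡ sum n f + sum n g
  ∑-distrib-+ zero    f g = refl
  ∑-distrib-+ (suc n) f g = trans (cong ((f 0 + g 0) +_) (∑-distrib-+ n _ _))
    (solve 4 (λ a b c d → a :+ b :+ (c :+ d) := a :+ c :+ (b :+ d)) refl (f 0) (g 0) (sum n _) (sum n _))

  ∑-distribˡ-* : ∀ n c (f : ℕ → ℚ) → ∑[ k < n ] (c * f k) ≡ c * sum n f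
  ∑-distribˡ-* zero    c f = sym (ℚₚ.*-zeroʳ c)
  ∑-distribˡ-* (suc n) c f = trans (cong (c * f 0 +_) (∑-distribˡ-* n c _)) (sym (ℚₚ.*-distribˡ-+ c (f 0) _))

  sum-const : ∀ n c → ∑[ k < n ] c ≡ fromℕ n * c
  sum-const zero    c = sym (ℚₚ.*-zeroˡ c)
  sum-const (suc n) c = begin
    c + sum n (λ _ → c)           ≡⟨ cong (c +_) (sum-const n c) ⟩
    c + fromℕ n * c               ≡⟨ solve 2 (λ c x → c :+ x :* c := (con 1ℚ :+ x) :* c) refl c (fromℕ n) ⟩
    (1ℚ + fromℕ n) * c            ≡⟨ cong (_* c) (sym (fromℕ-+ 1 n)) ⟩
    fromℕ (suc n) * c             ∎
    where open ≡-Reasoning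

  sum-init-last : ∀ n (f : ℕ → ℚ) → sum (suc n) f ≡ sum n f + f n
  sum-init-last zero    f = ℚₚ.+-comm (f 0) 0ℚ
  sum-init-last (suc n) f = trans (cong (f 0 +_) (sum-init-last n (λ k → f (suc k)))) (sym (ℚₚ.+-assoc (f 0) _ _))

  sum-++ : ∀ a b (f : ℕ → ℚ) → sum (a ℕ.+ b) f ≡ sum a f + ∑[ k < b ] f (a ℕ.+ k)
  sum-++ zero    b f = sym (ℚₚ.+-identityˡ _)
  sum-++ (suc a) b f = trans (cong (f 0 +_) (sum-++ a b (λ k → f (suc k)))) (sym (ℚₚ.+-assoc (f 0) _ _))

  ∑-distrib-- : ∀ n (f g : ℕ → ℚ) → ∑[ k < n ] (f k - g k) ≡ sum n f - sum n g
  ∑-distrib-- n f g = trans (∑-distrib-+ n f (λ k → - g k)) (cong (sum n f +_) (∑-neg n))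
    where
    ∑-neg : ∀ n {g : ℕ → ℚ} → ∑[ k < n ] (- g k) ≡ - sum n g
    ∑-neg zero    = refl
    ∑-neg (suc n) {g} = trans (cong (- g 0 +_) (∑-neg n)) (sym (ℚₚ.neg-distrib-+ (g 0) _))

  δ : ℕ → ℕ → ℚ
  δ a b with a ≟ b
  ... | yes _ = 1ℚ
  ... | no  _ = 0ℚ

  δ-refl : ∀ a → δ a a ≡ 1ℚ
  δ-refl a with a ≟ a
  ... | yes _  = refl
  ... | no a≢a = ⊥-elim (a≢a refl)

  δ-≢ : ∀ a b → ¬ a ≡ b → δ a b ≡ 0ℚ
  δ-≢ a b a≢b with a ≟ b
  ... | yes a≡b = ⊥-elim (a≢b a≡b)
  ... | no  _   = refl

  δ-cong-⇔ : ∀ {a b c d} → (a ≡ b → c ≡ d) → (c ≡ d → a ≡ b) → δ a b ≡ δ c d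
  δ-cong-⇔ {a} {b} {c} {d} to from with a ≟ b
  ... | yes a≡b = sym (δ-refl′ (to a≡b))
    where
    δ-refl′ : c ≡ d → δ c d ≡ 1ℚ
    δ-refl′ refl = δ-refl c
  ... | no a≢b  = sym (δ-≢ c d (λ c≡d → a≢b (from c≡d)))

  δ-sym : ∀ a b → δ a b ≡ δ b a
  δ-sym a b = δ-cong-⇔ {a} {b} {b} {a} sym sym

  δ-suc : ∀ a b → δ (suc a) (suc b) ≡ δ a b
  δ-suc a b = δ-cong-⇔ {suc a} {suc b} {a} {b} ℕₚ.suc-injective (cong suc)

  Id≡δ : ∀ {n} (i j : Fin n) → Id i j ≡ δ (toℕ i) (toℕ j)
  Id≡δ i j with toℕ i ≟ toℕ j
  ... | yes _ = refl
  ... | no  _ = refl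

  ∑-δ : ∀ n a (X : ℕ → ℚ) → a < n → ∑[ k < n ] (δ k a * X k) ≡ X a
  ∑-δ (suc n) zero    X _ = begin
    δ 0 0 * X 0 + ∑[ k < n ] (δ (suc k) 0 * X (suc k))  ≡⟨ cong₂ _+_ (cong (_* X 0) (δ-refl 0))
                                                             (sum-zero n (λ k _ → trans (cong (_* X (suc k)) (δ-≢ (suc k) 0 (λ ()))) (ℚₚ.*-zeroˡ (X (suc k))))) ⟩
    1ℚ * X 0 + 0ℚ                                       ≡⟨ solve 1 (λ x → con 1ℚ :* x :+ con 0ℚ := x) refl (X 0) ⟩
    X 0                                                 ∎
    where open ≡-Reasoning
  ∑-δ (suc n) (suc a) X (s≤s a<n) = begin
    δ 0 (suc a) * X 0 + ∑[ k < n ] (δ (suc k) (suc a) * X (suc k))  ≡⟨ cong₂ _+_ (cong (_* X 0) (δ-≢ 0 (suc a) (λ ())))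
                                                                         (sum-cong n (λ k _ → cong (_* X (suc k)) (δ-suc k a))) ⟩
    0ℚ * X 0 + ∑[ k < n ] (δ k a * X (suc k))                       ≡⟨ cong (0ℚ * X 0 +_) (∑-δ n a (λ k → X (suc k)) a<n) ⟩
    0ℚ * X 0 + X (suc a)                                            ≡⟨ solve 2 (λ x y → con 0ℚ :* x :+ y := y) refl (X 0) (X (suc a)) ⟩
    X (suc a)                                                       ∎
    where open ≡-Reasoning

  ∑-δ-outside : ∀ n a (X : ℕ → ℚ) → n ≤ a → ∑[ k < n ] (δ k a * X k) ≡ 0ℚ
  ∑-δ-outside n a X n≤a = sum-zero n (λ k k<n →
    trans (cong (_* X k) (δ-≢ k a (λ k≡a → ℕₚ.<-irrefl k≡a (ℕₚ.<-≤-trans k<n n≤a)))) (ℚₚ.*-zeroˡ (X k)))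

module Cycle (m′ : ℕ) where
  open import Data.Nat using (_+_; _∸_)

  m : ℕ
  m = suc m′

  -- Rim vertices are 0, …, m − 1 (the paper's 2, …, n); offset p q is (q − p) mod m.
  IsOffset : ℕ → ℕ → ℕ → Set
  IsOffset p q d = (p + d ≡ q) ⊎ (p + d ≡ q + m)

  offset : ℕ → ℕ → ℕ
  offset p q with p ≤? q
  ... | yes _ = q ∸ p
  ... | no  _ = q + m ∸ p

  private
    <m⇒≢+m : ∀ {a} b → a < m → ¬ a ≡ b + m
    <m⇒≢+m b a<m a≡b+m = ℕₚ.<-irrefl refl (ℕₚ.<-≤-trans a<m (subst (m ≤_) (sym a≡b+m) (ℕₚ.m≤n+m m b)))

    p≤q+m : ∀ {p} q → p < m → p ≤ q + m
    p≤q+m q p<m = ℕₚ.≤-trans (ℕₚ.<⇒≤ p<m) (ℕₚ.m≤n+m m q)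

    wrapped<m : ∀ {p q} → p < m → ¬ p ≤ q → q + m ∸ p < m
    wrapped<m {p} {q} p<m p≰q = ℕₚ.+-cancelˡ-< p (q + m ∸ p) m
      (subst (_< p + m) (sym (ℕₚ.m+[n∸m]≡n (p≤q+m q p<m))) (ℕₚ.+-monoˡ-< m (ℕₚ.≰⇒> p≰q)))

  offset-isOffset : ∀ p q → p < m → IsOffset p q (offset p q)
  offset-isOffset p q p<m with p ≤? q
  ... | yes p≤q = inj₁ (ℕₚ.m+[n∸m]≡n p≤q)
  ... | no  _   = inj₂ (ℕₚ.m+[n∸m]≡n (p≤q+m q p<m))

  offset<m : ∀ p q → p < m → q < m → offset p q < m
  offset<m p q p<m q<m with p ≤? q
  ... | yes _   = ℕₚ.≤-<-trans (ℕₚ.m∸n≤m q p) q<m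
  ... | no  p≰q = wrapped<m p<m p≰q

  isOffset-unique : ∀ {p q d d′} → d < m → d′ < m → IsOffset p q d → IsOffset p q d′ → d ≡ d′
  isOffset-unique {p} _ _ (inj₁ e) (inj₁ e′) = ℕₚ.+-cancelˡ-≡ p _ _ (trans e (sym e′))
  isOffset-unique {p} _ _ (inj₂ e) (inj₂ e′) = ℕₚ.+-cancelˡ-≡ p _ _ (trans e (sym e′))
  isOffset-unique {p} {d = d} {d′} _ d′<m (inj₁ e) (inj₂ e′) =
    ⊥-elim (<m⇒≢+m d d′<m (ℕₚ.+-cancelˡ-≡ p _ _ (trans e′ (trans (cong (_+ m) (sym e)) (ℕₚ.+-assoc p d m)))))
  isOffset-unique {p} {d = d} {d′} d<m _ (inj₂ e) (inj₁ e′) =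
    ⊥-elim (<m⇒≢+m d′ d<m (ℕₚ.+-cancelˡ-≡ p _ _ (trans e (trans (cong (_+ m) (sym e′)) (ℕₚ.+-assoc p d′ m)))))

  offset-unique : ∀ {p q d} → p < m → q < m → d < m → IsOffset p q d → offset p q ≡ d
  offset-unique {p} {q} p<m q<m d<m = isOffset-unique (offset<m p q p<m q<m) d<m (offset-isOffset p q p<m)

  circ-offset : ∀ p q → p < m → q < m → (q + m ∸ p) mod m ≡ offset p q
  circ-offset p q p<m q<m with p ≤? q
  ... | yes p≤q = trans (cong (_% m) (ℕₚ.+-∸-comm m p≤q))
                    (trans ([m+n]%n≡m%n (q ∸ p) m) (m<n⇒m%n≡m (ℕₚ.≤-<-trans (ℕₚ.m∸n≤m q p) q<m)))
  ... | no  p≰q = m<n⇒m%n≡m (wrapped<m p<m p≰q)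

  offset-self : ∀ p → p < m → offset p p ≡ 0
  offset-self p p<m = offset-unique p<m p<m (s≤s z≤n) (inj₁ (ℕₚ.+-identityʳ p))

  offset≡0⇒≡ : ∀ p q → p < m → offset p q ≡ 0 → q ≡ p
  offset≡0⇒≡ p q p<m e with offset-isOffset p q p<m
  ... | inj₁ r = trans (sym r) (trans (cong (p +_) e) (ℕₚ.+-identityʳ p))
  ... | inj₂ r = ⊥-elim (<m⇒≢+m q p<m (trans (sym (ℕₚ.+-identityʳ p)) (trans (cong (p +_) (sym e)) r)))

  offset-swap : ∀ p q → p < m → q < m → ¬ p ≡ q → offset q p ≡ m ∸ offset p q
  offset-swap p q p<m q<m p≢q = offset-unique q<m p<m (positive (offset p q) (λ e → p≢q (sym (offset≡0⇒≡ p q p<m e))))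
                                   (swap (offset p q) (ℕₚ.<⇒≤ (offset<m p q p<m q<m)) (offset-isOffset p q p<m))
    where
    positive : ∀ x → ¬ x ≡ 0 → m ∸ x < m
    positive zero    x≢0 = ⊥-elim (x≢0 refl)
    positive (suc x) _   = s≤s (ℕₚ.m∸n≤m m′ x)
    swap : ∀ x → x ≤ m → IsOffset p q x → IsOffset q p (m ∸ x)
    swap x x≤m (inj₁ r) = inj₂ (trans (cong (_+ (m ∸ x)) (sym r))
                            (trans (ℕₚ.+-assoc p x (m ∸ x)) (cong (p +_) (ℕₚ.m+[n∸m]≡n x≤m))))
    swap x x≤m (inj₂ r) = inj₁ (ℕₚ.+-cancelʳ-≡ x _ _ (trans (ℕₚ.+-assoc q (m ∸ x) x)
                            (trans (cong (q +_) (ℕₚ.m∸n+n≡m x≤m)) (sym r))))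

  next : ℕ → ℕ
  next p with suc p ≟ m
  ... | yes _ = 0
  ... | no  _ = suc p

  prev : ℕ → ℕ
  prev zero    = m′
  prev (suc p) = p

  next<m : ∀ p → p < m → next p < m
  next<m p p<m with suc p ≟ m
  ... | yes _    = s≤s z≤n
  ... | no  sp≢m = ℕₚ.≤∧≢⇒< p<m sp≢m

  prev<m : ∀ p → p < m → prev p < m
  prev<m zero    _   = ℕₚ.≤-refl
  prev<m (suc p) p<m = ℕₚ.<-trans (ℕₚ.n<1+n p) p<m

  next-prev : ∀ p → p < m → next (prev p) ≡ p
  next-prev zero    _ with m ≟ m
  ... | yes _   = refl
  ... | no  m≢m = ⊥-elim (m≢m refl)
  next-prev (suc p) sp<m with suc p ≟ m
  ... | yes sp≡m = ⊥-elim (ℕₚ.<-irrefl sp≡m sp<m)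
  ... | no  _    = refl

  prev-next : ∀ p → p < m → prev (next p) ≡ p
  prev-next p _ with suc p ≟ m
  ... | yes sp≡m = sym (ℕₚ.suc-injective sp≡m)
  ... | no  _    = refl

  isOffset-next : ∀ {p q} x → p < m → q < m → IsOffset p q x → IsOffset (next p) q (prev x)
  isOffset-next {p} x _ _ _ with suc p ≟ m
  isOffset-next zero _ _ (inj₁ r) | yes sp≡m = inj₁ (trans (sym (ℕₚ.suc-injective sp≡m)) (trans (sym (ℕₚ.+-identityʳ _)) r))
  isOffset-next zero _ _ (inj₁ r) | no  _    = inj₂ (trans (cong (λ z → suc z + m′) (trans (sym (ℕₚ.+-identityʳ _)) r))
                                                          (sym (ℕₚ.+-suc _ m′)))
  isOffset-next {q = q} zero p<m _ (inj₂ r) | _ = ⊥-elim (<m⇒≢+m q p<m (trans (sym (ℕₚ.+-identityʳ _)) r))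
  isOffset-next {p} (suc y) _ q<m (inj₁ r) | yes sp≡m =
    ⊥-elim (<m⇒≢+m y q<m (trans (sym r) (trans (ℕₚ.+-suc p y) (trans (cong (_+ y) sp≡m) (ℕₚ.+-comm m y)))))
  isOffset-next {p} (suc y) _ _ (inj₂ r) | yes sp≡m = inj₁ (ℕₚ.+-cancelʳ-≡ m _ _
                                                (trans (ℕₚ.+-comm y m) (trans (cong (_+ y) (sym sp≡m)) (trans (sym (ℕₚ.+-suc p y)) r))))
  isOffset-next {p} (suc y) _ _ (inj₁ r) | no _ = inj₁ (trans (sym (ℕₚ.+-suc p y)) r)
  isOffset-next {p} (suc y) _ _ (inj₂ r) | no _ = inj₂ (trans (sym (ℕₚ.+-suc p y)) r)

  offset-next : ∀ p q → p < m → q < m → offset (next p) q ≡ prev (offset p q)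
  offset-next p q p<m q<m = offset-unique (next<m p p<m) q<m (prev<m _ (offset<m p q p<m q<m))
    (isOffset-next (offset p q) p<m q<m (offset-isOffset p q p<m))

  offset-prev : ∀ p q → p < m → q < m → offset (prev p) q ≡ next (offset p q)
  offset-prev p q p<m q<m = begin
    offset (prev p) q                      ≡⟨ sym (next-prev _ (offset<m _ q (prev<m p p<m) q<m)) ⟩
    next (prev (offset (prev p) q))        ≡⟨ cong next (sym (offset-next (prev p) q (prev<m p p<m) q<m)) ⟩
    next (offset (next (prev p)) q)        ≡⟨ cong (λ r → next (offset r q)) (next-prev p p<m) ⟩
    next (offset p q)                      ∎
    where open ≡-Reasoning

module DistanceRow (m′ : ℕ) (2≤m′ : 2 ≤ m′) where
  open import Data.Rational using (_+_; _*_; _-_; -_)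
  open Cycle m′
  open +-*-Solver

  private
    m′≢0 : ¬ m′ ≡ 0
    m′≢0 m′≡0 = ℕₚ.<-irrefl (sym m′≡0) (ℕₚ.<-≤-trans (s≤s z≤n) 2≤m′)

    m′≢1 : ¬ m′ ≡ 1
    m′≢1 m′≡1 = ℕₚ.<-irrefl (sym m′≡1) 2≤m′

  δ-offset-0 : ∀ p q → p < m → q < m → δ (offset p q) 0 ≡ δ q p
  δ-offset-0 p q p<m q<m = δ-cong-⇔ (offset≡0⇒≡ p q p<m) (λ q≡p → trans (cong (offset p) q≡p) (offset-self p p<m))

  δ-prev-0 : ∀ x → δ (prev x) 0 ≡ δ x 1
  δ-prev-0 zero    = δ-≢ m′ 0 m′≢0
  δ-prev-0 (suc x) = sym (δ-suc x 0)

  δ-next-0 : ∀ x → x < m → δ (next x) 0 ≡ δ x m′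
  δ-next-0 x x<m with suc x ≟ m
  ... | yes sx≡m = trans (δ-refl 0) (sym (trans (cong (λ y → δ y m′) (ℕₚ.suc-injective sx≡m)) (δ-refl m′)))
  ... | no  sx≢m = sym (δ-≢ x m′ (λ x≡m′ → sx≢m (cong suc x≡m′)))

  δ-offset-1 : ∀ p q → p < m → q < m → δ (offset p q) 1 ≡ δ q (next p)
  δ-offset-1 p q p<m q<m = begin
    δ (offset p q) 1           ≡⟨ sym (δ-prev-0 (offset p q)) ⟩
    δ (prev (offset p q)) 0    ≡⟨ cong (λ x → δ x 0) (sym (offset-next p q p<m q<m)) ⟩
    δ (offset (next p) q) 0    ≡⟨ δ-offset-0 (next p) q (next<m p p<m) q<m ⟩
    δ q (next p)               ∎
    where open ≡-Reasoning

  δ-offset-m′ : ∀ p q → p < m → q < m → δ (offset p q) m′ ≡ δ q (prev p)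
  δ-offset-m′ p q p<m q<m = begin
    δ (offset p q) m′          ≡⟨ sym (δ-next-0 (offset p q) (offset<m p q p<m q<m)) ⟩
    δ (next (offset p q)) 0    ≡⟨ cong (λ x → δ x 0) (sym (offset-prev p q p<m q<m)) ⟩
    δ (offset (prev p) q) 0    ≡⟨ δ-offset-0 (prev p) q (prev<m p p<m) q<m ⟩
    δ q (prev p)               ∎
    where open ≡-Reasoning

  distRow-δ : ∀ d → distRow m d ≡ fromℕ 2 - fromℕ 2 * δ d 0 - δ d 1 - δ d m′
  distRow-δ zero          rewrite δ-≢ 0 m′ (λ 0≡m′ → m′≢0 (sym 0≡m′)) = refl
  distRow-δ (suc zero)    rewrite δ-≢ 1 m′ (λ 1≡m′ → m′≢1 (sym 1≡m′)) = refl
  distRow-δ (suc (suc j)) with suc (suc j) ≟ m′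
  ... | yes _ = refl
  ... | no  _ = refl

  distRow-offset : ∀ p q → p < m → q < m →
    distRow m (offset p q) ≡ fromℕ 2 - fromℕ 2 * δ q p - δ q (next p) - δ q (prev p)
  distRow-offset p q p<m q<m = begin
    distRow m (offset p q)
      ≡⟨ distRow-δ (offset p q) ⟩
    fromℕ 2 - fromℕ 2 * δ (offset p q) 0 - δ (offset p q) 1 - δ (offset p q) m′
      ≡⟨ cong₂ (λ a b → fromℕ 2 - fromℕ 2 * a - b - δ (offset p q) m′) (δ-offset-0 p q p<m q<m) (δ-offset-1 p q p<m q<m) ⟩
    fromℕ 2 - fromℕ 2 * δ q p - δ q (next p) - δ (offset p q) m′
      ≡⟨ cong (λ c → fromℕ 2 - fromℕ 2 * δ q p - δ q (next p) - c) (δ-offset-m′ p q p<m q<m) ⟩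
    fromℕ 2 - fromℕ 2 * δ q p - δ q (next p) - δ q (prev p) ∎
    where open ≡-Reasoning

  δ-next : ∀ p q → p < m → q < m → δ q (next p) ≡ δ p (prev q)
  δ-next p q p<m q<m = δ-cong-⇔ (λ q≡np → trans (sym (prev-next p p<m)) (cong prev (sym q≡np)))
                                (λ p≡pq → trans (sym (next-prev q q<m)) (cong next (sym p≡pq)))

  distRow-offset-sym : ∀ p q → p < m → q < m → distRow m (offset p q) ≡ distRow m (offset q p)
  distRow-offset-sym p q p<m q<m = begin
    distRow m (offset p q)
      ≡⟨ distRow-offset p q p<m q<m ⟩
    fromℕ 2 - fromℕ 2 * δ q p - δ q (next p) - δ q (prev p)
      ≡⟨ cong₂ (λ a b → fromℕ 2 - fromℕ 2 * a - b - δ q (prev p)) (δ-sym q p) (δ-next p q p<m q<m) ⟩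
    fromℕ 2 - fromℕ 2 * δ p q - δ p (prev q) - δ q (prev p)
      ≡⟨ cong (λ c → fromℕ 2 - fromℕ 2 * δ p q - δ p (prev q) - c) (sym (δ-next q p q<m p<m)) ⟩
    fromℕ 2 - fromℕ 2 * δ p q - δ p (prev q) - δ p (next q)
      ≡⟨ solve 4 (λ a b c d → a :- b :- c :- d := a :- b :- d :- c) refl (fromℕ 2) (fromℕ 2 * δ p q) (δ p (prev q)) (δ p (next q)) ⟩
    fromℕ 2 - fromℕ 2 * δ p q - δ p (next q) - δ p (prev q)
      ≡⟨ sym (distRow-offset q p q<m p<m) ⟩
    distRow m (offset q p) ∎
    where open ≡-Reasoning

  ∑-distRow-offset : ∀ p (Y : ℕ → ℚ) → p < m →
    ∑[ q < m ] (distRow m (offset p q) * Y q) ≡ fromℕ 2 * sum m Y - fromℕ 2 * Y p - Y (next p) - Y (prev p)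
  ∑-distRow-offset p Y p<m = begin
    ∑[ q < m ] (distRow m (offset p q) * Y q)
      ≡⟨ sum-cong m (λ q q<m → trans (cong (_* Y q) (distRow-offset p q p<m q<m))
                                      (expand (δ q p) (δ q (next p)) (δ q (prev p)) (Y q))) ⟩
    ∑[ q < m ] (fromℕ 2 * Y q - fromℕ 2 * (δ q p * Y q) - δ q (next p) * Y q - δ q (prev p) * Y q)
      ≡⟨ ∑-distrib-- m (λ q → fromℕ 2 * Y q - fromℕ 2 * (δ q p * Y q) - δ q (next p) * Y q) (λ q → δ q (prev p) * Y q) ⟩
    ∑[ q < m ] (fromℕ 2 * Y q - fromℕ 2 * (δ q p * Y q) - δ q (next p) * Y q) - ∑[ q < m ] (δ q (prev p) * Y q)
      ≡⟨ cong₂ _-_ (∑-distrib-- m (λ q → fromℕ 2 * Y q - fromℕ 2 * (δ q p * Y q)) (λ q → δ q (next p) * Y q))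
                   (∑-δ m (prev p) Y (prev<m p p<m)) ⟩
    ∑[ q < m ] (fromℕ 2 * Y q - fromℕ 2 * (δ q p * Y q)) - ∑[ q < m ] (δ q (next p) * Y q) - Y (prev p)
      ≡⟨ cong₂ (λ a b → a - b - Y (prev p)) (∑-distrib-- m (λ q → fromℕ 2 * Y q) (λ q → fromℕ 2 * (δ q p * Y q)))
                                             (∑-δ m (next p) Y (next<m p p<m)) ⟩
    ∑[ q < m ] (fromℕ 2 * Y q) - ∑[ q < m ] (fromℕ 2 * (δ q p * Y q)) - Y (next p) - Y (prev p)
      ≡⟨ cong₂ (λ a b → a - b - Y (next p) - Y (prev p)) (∑-distribˡ-* m (fromℕ 2) Y)
               (trans (∑-distribˡ-* m (fromℕ 2) (λ q → δ q p * Y q)) (cong (fromℕ 2 *_) (∑-δ m p Y p<m))) ⟩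
    fromℕ 2 * sum m Y - fromℕ 2 * Y p - Y (next p) - Y (prev p) ∎
    where
    open ≡-Reasoning
    expand : ∀ a b c y → (fromℕ 2 - fromℕ 2 * a - b - c) * y ≡ fromℕ 2 * y - fromℕ 2 * (a * y) - b * y - c * y
    expand = solve 4 (λ a b c y → (con (fromℕ 2) :- con (fromℕ 2) :* a :- b :- c) :* y
                                 := con (fromℕ 2) :* y :- con (fromℕ 2) :* (a :* y) :- b :* y :- c :* y) refl

  ∑-offset : ∀ q (G : ℕ → ℚ) → q < m → ∑[ p < m ] G (offset q p) ≡ sum m G
  ∑-offset q G q<m = begin
    ∑[ p < m ] G (offset q p)                          ≡⟨ cong (λ z → ∑[ p < z ] G (offset q p)) (sym q+r≡m) ⟩
    ∑[ p < q ℕ.+ r ] G (offset q p)                    ≡⟨ sum-++ q r (λ p → G (offset q p)) ⟩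
    ∑[ p < q ] G (offset q p) + ∑[ k < r ] G (offset q (q ℕ.+ k))
      ≡⟨ cong₂ _+_ (sum-cong q (λ p p<q → cong G (wrapped p p<q))) (sum-cong r (λ k k<r → cong G (unwrapped k k<r))) ⟩
    ∑[ p < q ] G (r ℕ.+ p) + sum r G                   ≡⟨ ℚₚ.+-comm _ (sum r G) ⟩
    sum r G + ∑[ p < q ] G (r ℕ.+ p)                   ≡⟨ sym (sum-++ r q G) ⟩
    sum (r ℕ.+ q) G                                    ≡⟨ cong (λ z → sum z G) (trans (ℕₚ.+-comm r q) q+r≡m) ⟩
    sum m G                                            ∎
    where
    open ≡-Reasoning
    r = m ℕ.∸ q
    q+r≡m : q ℕ.+ r ≡ m
    q+r≡m = ℕₚ.m+[n∸m]≡n (ℕₚ.<⇒≤ q<m)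
    wrapped : ∀ p → p < q → offset q p ≡ r ℕ.+ p
    wrapped p p<q = offset-unique q<m (ℕₚ.<-trans p<q q<m)
      (subst (r ℕ.+ p <_) q+r≡m (subst (ℕ._< q ℕ.+ r) (ℕₚ.+-comm p r) (ℕₚ.+-monoˡ-< r p<q)))
      (inj₂ (trans (sym (ℕₚ.+-assoc q r p)) (trans (cong (ℕ._+ p) q+r≡m) (ℕₚ.+-comm m p))))
    unwrapped : ∀ k → k < r → offset q (q ℕ.+ k) ≡ k
    unwrapped k k<r = offset-unique q<m (subst (q ℕ.+ k <_) q+r≡m (ℕₚ.+-monoʳ-< q k<r))
                        (ℕₚ.<-≤-trans k<r (ℕₚ.m∸n≤m m q)) (inj₁ refl)

module _ where
  open import Data.Rational using (_+_; _*_; _-_; -_)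
  open +-*-Solver

  sign : ℕ → ℚ
  sign e = fromℤ (sgn e)

  sign-suc : ∀ e → sign (suc e) ≡ - sign e
  sign-suc e = fromℤ-neg (sgn e)

  sign-+ : ∀ a b → sign (a ℕ.+ b) ≡ sign a * sign b
  sign-+ zero    b = sym (ℚₚ.*-identityˡ (sign b))
  sign-+ (suc a) b = begin
    sign (suc (a ℕ.+ b))      ≡⟨ sign-suc (a ℕ.+ b) ⟩
    - sign (a ℕ.+ b)          ≡⟨ cong -_ (sign-+ a b) ⟩
    - (sign a * sign b)       ≡⟨ ℚₚ.neg-distribˡ-* (sign a) (sign b) ⟩
    - sign a * sign b         ≡⟨ cong (_* sign b) (sym (sign-suc a)) ⟩
    sign (suc a) * sign b     ∎
    where open ≡-Reasoning

  sign-double : ∀ a → sign (a ℕ.+ a) ≡ 1ℚ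
  sign-double zero    = refl
  sign-double (suc a) = begin
    sign (suc (a ℕ.+ suc a))  ≡⟨ cong (λ x → sign (suc x)) (ℕₚ.+-suc a a) ⟩
    sign (suc (suc (a ℕ.+ a))) ≡⟨ trans (sign-suc (suc (a ℕ.+ a))) (cong -_ (sign-suc (a ℕ.+ a))) ⟩
    - - sign (a ℕ.+ a)        ≡⟨ solve 1 (λ x → :- (:- x) := x) refl _ ⟩
    sign (a ℕ.+ a)            ≡⟨ sign-double a ⟩
    1ℚ                        ∎
    where open ≡-Reasoning

module Coefficient (t : ℕ) where
  open import Data.Rational using (_+_; _*_; _-_; -_)
  open +-*-Solver

  m : ℕ
  m = suc (t ℕ.+ t)

  -- The coefficient of C_e in specialL; its subtraction is truncated, so it agrees
  -- with coeff only when 2e ≤ m.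
  rawCoeff : ℕ → ℚ
  rawCoeff e = (sgn e ℤ.* ℤ.+ (m ℕ.∸ 2 ℕ.* e)) ℚ./ 2

  coeff : ℕ → ℚ
  coeff e = sign e * (fromℕ m - fromℕ 2 * fromℕ e) * ½

  sign-m : sign m ≡ - 1ℚ
  sign-m = trans (sign-suc (t ℕ.+ t)) (cong -_ (sign-double t))

  sign-reflect : ∀ a b → a ℕ.+ b ≡ m → sign b ≡ - sign a
  sign-reflect a b a+b≡m = begin
    sign b                      ≡⟨ sym (ℚₚ.*-identityˡ (sign b)) ⟩
    1ℚ * sign b                 ≡⟨ cong (_* sign b) (trans (sym (sign-double a)) (sign-+ a a)) ⟩
    sign a * sign a * sign b    ≡⟨ ℚₚ.*-assoc (sign a) (sign a) (sign b) ⟩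
    sign a * (sign a * sign b)  ≡⟨ cong (sign a *_) (trans (sym (sign-+ a b)) (trans (cong sign a+b≡m) sign-m)) ⟩
    sign a * - 1ℚ              ≡⟨ solve 1 (λ s → s :* (:- con 1ℚ) := :- s) refl (sign a) ⟩
    - sign a                    ∎
    where open ≡-Reasoning

  coeff-reflect : ∀ a b → a ℕ.+ b ≡ m → coeff a ≡ coeff b
  coeff-reflect a b a+b≡m = begin
    sign a * (fromℕ m - fromℕ 2 * fromℕ a) * ½
      ≡⟨ cong (λ x → sign a * (x - fromℕ 2 * fromℕ a) * ½) M≡a+b ⟩
    sign a * (fromℕ a + fromℕ b - fromℕ 2 * fromℕ a) * ½
      ≡⟨ solve 3 (λ s a b → s :* (a :+ b :- con (fromℕ 2) :* a) :* con ½
                         := (:- s) :* (a :+ b :- con (fromℕ 2) :* b) :* con ½) refl (sign a) (fromℕ a) (fromℕ b) ⟩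
    - sign a * (fromℕ a + fromℕ b - fromℕ 2 * fromℕ b) * ½
      ≡⟨ cong₂ (λ s x → s * (x - fromℕ 2 * fromℕ b) * ½) (sym (sign-reflect a b a+b≡m)) (sym M≡a+b) ⟩
    sign b * (fromℕ m - fromℕ 2 * fromℕ b) * ½ ∎
    where
    open ≡-Reasoning
    M≡a+b : fromℕ m ≡ fromℕ a + fromℕ b
    M≡a+b = trans (cong fromℕ (sym a+b≡m)) (fromℕ-+ a b)

  coeff-suc : ∀ e → coeff (suc e) ≡ - sign e * (fromℕ m - fromℕ 2 * (1ℚ + fromℕ e)) * ½
  coeff-suc e = cong₂ (λ s x → s * (fromℕ m - fromℕ 2 * x) * ½) (sign-suc e) (fromℕ-+ 1 e)

  coeff-recurrence : ∀ e → fromℕ 2 * coeff (suc e) + coeff e + coeff (suc (suc e)) ≡ 0ℚ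
  coeff-recurrence e = begin
    fromℕ 2 * coeff (suc e) + coeff e + coeff (suc (suc e))
      ≡⟨ cong₂ (λ a b → fromℕ 2 * a + coeff e + b) (coeff-suc e)
           (trans (coeff-suc (suc e)) (cong₂ (λ s x → - s * (fromℕ m - fromℕ 2 * (1ℚ + x)) * ½) (sign-suc e) (fromℕ-+ 1 e))) ⟩
    fromℕ 2 * (- sign e * (fromℕ m - fromℕ 2 * (1ℚ + fromℕ e)) * ½) + coeff e
      + - - sign e * (fromℕ m - fromℕ 2 * (1ℚ + (1ℚ + fromℕ e))) * ½
      ≡⟨ solve 3 (λ s M x → con (fromℕ 2) :* ((:- s) :* (M :- con (fromℕ 2) :* (con 1ℚ :+ x)) :* con ½)
                             :+ s :* (M :- con (fromℕ 2) :* x) :* con ½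
                             :+ (:- (:- s)) :* (M :- con (fromℕ 2) :* (con 1ℚ :+ (con 1ℚ :+ x))) :* con ½ := con 0ℚ)
           refl (sign e) (fromℕ m) (fromℕ e) ⟩
    0ℚ ∎
    where open ≡-Reasoning

  coeff-base : fromℕ 2 * coeff 0 + coeff 1 + coeff 1 ≡ fromℕ 2
  coeff-base = solve 1 (λ M → con (fromℕ 2) :* (con (sign 0) :* (M :- con (fromℕ 2) :* con (fromℕ 0)) :* con ½)
                             :+ con (sign 1) :* (M :- con (fromℕ 2) :* con (fromℕ 1)) :* con ½
                             :+ con (sign 1) :* (M :- con (fromℕ 2) :* con (fromℕ 1)) :* con ½ := con (fromℕ 2))
                 refl (fromℕ m)

  ∑-coeff : ∀ u → sum u coeff ≡ (fromℕ m + 1ℚ) * ½ * ½ * (1ℚ - sign u) + fromℕ u * sign u * ½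
  ∑-coeff zero    = solve 1 (λ M → con 0ℚ := (M :+ con 1ℚ) :* con ½ :* con ½ :* (con 1ℚ :- con 1ℚ) :+ con 0ℚ :* con 1ℚ :* con ½)
                      refl (fromℕ m)
  ∑-coeff (suc u) = begin
    sum (suc u) coeff
      ≡⟨ sum-init-last u coeff ⟩
    sum u coeff + coeff u
      ≡⟨ cong (_+ coeff u) (∑-coeff u) ⟩
    (fromℕ m + 1ℚ) * ½ * ½ * (1ℚ - sign u) + fromℕ u * sign u * ½ + sign u * (fromℕ m - fromℕ 2 * fromℕ u) * ½
      ≡⟨ solve 3 (λ s M x → (M :+ con 1ℚ) :* con ½ :* con ½ :* (con 1ℚ :- s) :+ x :* s :* con ½ :+ s :* (M :- con (fromℕ 2) :* x) :* con ½
                          := (M :+ con 1ℚ) :* con ½ :* con ½ :* (con 1ℚ :- (:- s)) :+ (con 1ℚ :+ x) :* (:- s) :* con ½)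
           refl (sign u) (fromℕ m) (fromℕ u) ⟩
    (fromℕ m + 1ℚ) * ½ * ½ * (1ℚ - - sign u) + (1ℚ + fromℕ u) * - sign u * ½
      ≡⟨ cong₂ (λ s x → (fromℕ m + 1ℚ) * ½ * ½ * (1ℚ - s) + x * s * ½) (sym (sign-suc u)) (sym (fromℕ-+ 1 u)) ⟩
    (fromℕ m + 1ℚ) * ½ * ½ * (1ℚ - sign (suc u)) + fromℕ (suc u) * sign (suc u) * ½ ∎
    where open ≡-Reasoning

  ∑-coeff-m : sum m coeff ≡ ½
  ∑-coeff-m = begin
    sum m coeff
      ≡⟨ ∑-coeff m ⟩
    (fromℕ m + 1ℚ) * ½ * ½ * (1ℚ - sign m) + fromℕ m * sign m * ½
      ≡⟨ cong (λ s → (fromℕ m + 1ℚ) * ½ * ½ * (1ℚ - s) + fromℕ m * s * ½) sign-m ⟩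
    (fromℕ m + 1ℚ) * ½ * ½ * (1ℚ - - 1ℚ) + fromℕ m * - 1ℚ * ½
      ≡⟨ solve 1 (λ M → (M :+ con 1ℚ) :* con ½ :* con ½ :* (con 1ℚ :- (:- con 1ℚ)) :+ M :* (:- con 1ℚ) :* con ½ := con ½)
           refl (fromℕ m) ⟩
    ½ ∎
    where open ≡-Reasoning

  rawCoeff≡coeff : ∀ e → 2 ℕ.* e ≤ m → rawCoeff e ≡ coeff e
  rawCoeff≡coeff e 2e≤m = begin
    (sgn e ℤ.* ℤ.+ (m ℕ.∸ 2 ℕ.* e)) ℚ./ 2        ≡⟨ /-suc (sgn e ℤ.* ℤ.+ (m ℕ.∸ 2 ℕ.* e)) 1 ⟩
    fromℤ (sgn e ℤ.* ℤ.+ (m ℕ.∸ 2 ℕ.* e)) * ½    ≡⟨ cong (_* ½) (fromℤ-* (sgn e) (ℤ.+ (m ℕ.∸ 2 ℕ.* e))) ⟩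
    sign e * fromℕ (m ℕ.∸ 2 ℕ.* e) * ½            ≡⟨ cong (λ x → sign e * x * ½) (trans (fromℕ-∸ 2e≤m) (cong (λ x → fromℕ m - x) (fromℕ-* 2 e))) ⟩
    coeff e                                       ∎
    where open ≡-Reasoning

module _ where
  open import Data.Rational using (_+_; _*_)

  sumFin-cong : ∀ {n} {f g : Fin n → ℚ} → (∀ k → f k ≡ g k) → sumFin f ≡ sumFin g
  sumFin-cong {zero}  eq = refl
  sumFin-cong {suc n} eq = cong₂ _+_ (eq Fin.zero) (sumFin-cong (λ k → eq (Fin.suc k)))

  sumFin-toℕ : ∀ n (f : ℕ → ℚ) → sumFin {n} (λ k → f (toℕ k)) ≡ sum n f
  sumFin-toℕ zero    f = refl
  sumFin-toℕ (suc n) f = cong (f 0 +_) (sumFin-toℕ n (λ k → f (suc k)))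

  ⊗-toℕ : ∀ {n} {A B : Matrix n} (A′ B′ : ℕ → ℕ → ℚ) →
          (∀ i j → A i j ≡ A′ (toℕ i) (toℕ j)) → (∀ i j → B i j ≡ B′ (toℕ i) (toℕ j)) →
          ∀ i j → (A ⊗ B) i j ≡ ∑[ k < n ] (A′ (toℕ i) k * B′ k (toℕ j))
  ⊗-toℕ {n} A′ B′ A≡A′ B≡B′ i j =
    trans (sumFin-cong (λ k → cong₂ _*_ (A≡A′ i k) (B≡B′ k j))) (sumFin-toℕ n (λ k → A′ (toℕ i) k * B′ k (toℕ j)))

  sumM-applyUpTo : ∀ {N} (F : ℕ → Matrix N) (f : ℕ → ℕ) u i j →
    sumM (map F (map suc (applyUpTo f u))) i j ≡ ∑[ k < u ] F (suc (f k)) i j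
  sumM-applyUpTo F f zero    i j = refl
  sumM-applyUpTo F f (suc u) i j = cong (F (suc (f 0)) i j +_) (sumM-applyUpTo F (λ k → f (suc k)) u i j)

  blockℕ-cong : ∀ {m} {x : ℚ} {r c : ℕ → ℚ} {inner inner′ : ℕ → ℕ → ℚ} →
                (∀ p q → p < m → q < m → inner p q ≡ inner′ p q) →
                ∀ a b → a < suc m → b < suc m → blockℕ x r c inner a b ≡ blockℕ x r c inner′ a b
  blockℕ-cong eq zero    zero    _ _ = refl
  blockℕ-cong eq zero    (suc q) _ _ = refl
  blockℕ-cong eq (suc p) zero    _ _ = refl
  blockℕ-cong eq (suc p) (suc q) (s≤s p<m) (s≤s q<m) = eq p q p<m q<m

module Wheel (t : ℕ) (1≤t : 1 ≤ t) where
  open import Data.Rational using (_+_; _*_; _-_; -_)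
  open +-*-Solver
  open Cycle (t ℕ.+ t)
  open DistanceRow (t ℕ.+ t) (ℕₚ.+-mono-≤ 1≤t 1≤t)
  open Coefficient t hiding (m)

  m′ : ℕ
  m′ = t ℕ.+ t

  n : ℕ
  n = suc m

  -- c^k has its ones at offsets k and m − k, where coeff takes the same value, so the
  -- rim block of specialL is Circ(coeff) (see laplacian-expansion).
  D L : ℕ → ℕ → ℚ
  D = blockℕ 0ℚ one one (λ p q → distRow m (offset p q))
  L = blockℕ (fromℕ m * ½) (λ _ → - ½) (λ _ → - ½) (λ p q → coeff (offset p q))

  ¼ : ℚ
  ¼ = ℤ.+ 1 ℚ./ 4

  w : ℕ → ℚ
  w zero    = (fromℕ 4 - fromℕ m) * ¼
  w (suc _) = ¼

  C : ℕ → ℕ → ℚ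
  C a b = - ½ * L a b + (ℤ.+ 4 ℚ./ m) * (w a * w b)

  ck-δ : ∀ k d → k < t → ck n (suc k) d ≡ δ d (suc k) + δ d (m′ ℕ.∸ k)
  ck-δ k d k<t = trans (ck-distinct (λ e → ℕₚ.<-irrefl (trans e m′∸k≡) k+1<m′∸k)) (cong (λ z → δ d (suc k) + δ d z) m′∸k≡)
    where
    m′∸k≡ : n ℕ.∸ suc k ℕ.∸ 1 ≡ m′ ℕ.∸ k
    m′∸k≡ = trans (ℕₚ.∸-+-assoc m k 1) (cong (m ℕ.∸_) (ℕₚ.+-comm k 1))
    k+1<m′∸k : suc k < m′ ℕ.∸ k
    k+1<m′∸k = subst (suc (suc k) ≤_) (sym (ℕₚ.+-∸-assoc t (ℕₚ.<⇒≤ k<t)))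
                 (subst (_≤ t ℕ.+ (t ℕ.∸ k)) (ℕₚ.+-comm (suc k) 1) (ℕₚ.+-mono-≤ k<t (ℕₚ.m<n⇒0<n∸m k<t)))
    ck-distinct : ¬ suc k ≡ n ℕ.∸ suc k ℕ.∸ 1 → ck n (suc k) d ≡ δ d (suc k) + δ d (n ℕ.∸ suc k ℕ.∸ 1)
    ck-distinct k≢ with d ≟ suc k | d ≟ n ℕ.∸ suc k ℕ.∸ 1
    ... | yes d≡k | yes d≡k′ = ⊥-elim (k≢ (trans (sym d≡k) d≡k′))
    ... | yes _   | no  _    = refl
    ... | no  _   | yes _    = refl
    ... | no  _   | no  _    = refl

  δ-reflect : ∀ {a b} → a ≤ m′ → b ≤ m′ → δ a (m′ ℕ.∸ b) ≡ δ b (m′ ℕ.∸ a)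
  δ-reflect {a} {b} a≤m′ b≤m′ = δ-cong-⇔ {a} {m′ ℕ.∸ b} {b} {m′ ℕ.∸ a}
    (λ e → trans (sym (ℕₚ.m∸[m∸n]≡n b≤m′)) (cong (m′ ℕ.∸_) (sym e)))
    (λ e → trans (sym (ℕₚ.m∸[m∸n]≡n a≤m′)) (cong (m′ ℕ.∸_) (sym e)))

  ∑-coeff-ck : ∀ d → d ≤ m′ → ∑[ k < t ] (coeff (suc k) * ck n (suc k) d)
               ≡ ∑[ k < t ] (δ d (suc k) * coeff (suc k)) + ∑[ k < t ] (δ k (m′ ℕ.∸ d) * coeff (suc k))
  ∑-coeff-ck d d≤m′ = trans (sum-cong t split) (∑-distrib-+ t (λ k → δ d (suc k) * coeff (suc k)) (λ k → δ k (m′ ℕ.∸ d) * coeff (suc k)))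
    where
    split : ∀ k → k < t → coeff (suc k) * ck n (suc k) d ≡ δ d (suc k) * coeff (suc k) + δ k (m′ ℕ.∸ d) * coeff (suc k)
    split k k<t = begin
      coeff (suc k) * ck n (suc k) d
        ≡⟨ cong (coeff (suc k) *_) (ck-δ k d k<t) ⟩
      coeff (suc k) * (δ d (suc k) + δ d (m′ ℕ.∸ k))
        ≡⟨ cong (λ x → coeff (suc k) * (δ d (suc k) + x)) (δ-reflect d≤m′ (ℕₚ.≤-trans (ℕₚ.<⇒≤ k<t) (ℕₚ.m≤m+n t t))) ⟩
      coeff (suc k) * (δ d (suc k) + δ k (m′ ℕ.∸ d))
        ≡⟨ solve 3 (λ c a b → c :* (a :+ b) := a :* c :+ b :* c) refl (coeff (suc k)) (δ d (suc k)) (δ k (m′ ℕ.∸ d)) ⟩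
      δ d (suc k) * coeff (suc k) + δ k (m′ ℕ.∸ d) * coeff (suc k) ∎
      where open ≡-Reasoning

  laplacian-cycle-entry : ∀ d → d < m → fromℕ m * ½ * δ d 0 + ∑[ k < t ] (coeff (suc k) * ck n (suc k) d) ≡ coeff d
  laplacian-cycle-entry zero _ = begin
    fromℕ m * ½ * 1ℚ + ∑[ k < t ] (coeff (suc k) * ck n (suc k) 0)
      ≡⟨ cong (fromℕ m * ½ * 1ℚ +_) (trans (∑-coeff-ck 0 z≤n)
           (cong₂ _+_ (sum-zero t (λ k _ → ℚₚ.*-zeroˡ (coeff (suc k)))) (∑-δ-outside t m′ (λ k → coeff (suc k)) (ℕₚ.m≤m+n t t)))) ⟩
    fromℕ m * ½ * 1ℚ + (0ℚ + 0ℚ)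
      ≡⟨ solve 1 (λ M → M :* con ½ :* con 1ℚ :+ (con 0ℚ :+ con 0ℚ)
                      := con (sign 0) :* (M :- con (fromℕ 2) :* con (fromℕ 0)) :* con ½) refl (fromℕ m) ⟩
    coeff 0 ∎
    where open ≡-Reasoning
  laplacian-cycle-entry (suc d) sd<m with suc d ≤? t
  ... | yes sd≤t = begin
    fromℕ m * ½ * 0ℚ + ∑[ k < t ] (coeff (suc k) * ck n (suc k) (suc d))
      ≡⟨ cong (fromℕ m * ½ * 0ℚ +_) (trans (∑-coeff-ck (suc d) (ℕₚ.≤-pred sd<m))
           (cong₂ _+_ (trans (sum-cong t (λ k _ → cong (_* coeff (suc k)) (trans (δ-suc d k) (δ-sym d k))))
                             (∑-δ t d (λ k → coeff (suc k)) sd≤t))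
                      (∑-δ-outside t (m′ ℕ.∸ suc d) (λ k → coeff (suc k)) t≤m′∸sd))) ⟩
    fromℕ m * ½ * 0ℚ + (coeff (suc d) + 0ℚ)
      ≡⟨ solve 2 (λ M c → M :* con ½ :* con 0ℚ :+ (c :+ con 0ℚ) := c) refl (fromℕ m) (coeff (suc d)) ⟩
    coeff (suc d) ∎
    where
    open ≡-Reasoning
    t≤m′∸sd : t ≤ m′ ℕ.∸ suc d
    t≤m′∸sd = subst (_≤ m′ ℕ.∸ suc d) (ℕₚ.m+n∸n≡m t t) (ℕₚ.∸-monoʳ-≤ m′ sd≤t)
  ... | no  sd≰t = begin
    fromℕ m * ½ * 0ℚ + ∑[ k < t ] (coeff (suc k) * ck n (suc k) (suc d))
      ≡⟨ cong (fromℕ m * ½ * 0ℚ +_) (trans (∑-coeff-ck (suc d) sd≤m′)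
           (cong₂ _+_ (trans (sum-cong t (λ k _ → cong (_* coeff (suc k)) (trans (δ-suc d k) (δ-sym d k))))
                             (∑-δ-outside t d (λ k → coeff (suc k)) (ℕₚ.≤-pred (ℕₚ.≰⇒> sd≰t))))
                      (∑-δ t (m′ ℕ.∸ suc d) (λ k → coeff (suc k)) m′∸sd<t))) ⟩
    fromℕ m * ½ * 0ℚ + (0ℚ + coeff (suc (m′ ℕ.∸ suc d)))
      ≡⟨ solve 2 (λ M c → M :* con ½ :* con 0ℚ :+ (con 0ℚ :+ c) := c) refl (fromℕ m) (coeff (suc (m′ ℕ.∸ suc d))) ⟩
    coeff (suc (m′ ℕ.∸ suc d))
      ≡⟨ coeff-reflect (suc (m′ ℕ.∸ suc d)) (suc d) (cong suc (ℕₚ.m∸n+n≡m sd≤m′)) ⟩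
    coeff (suc d) ∎
    where
    open ≡-Reasoning
    sd≤m′ : suc d ≤ m′
    sd≤m′ = ℕₚ.≤-pred sd<m
    m′∸sd<t : m′ ℕ.∸ suc d < t
    m′∸sd<t = subst (m′ ℕ.∸ suc d <_) (ℕₚ.m+n∸n≡m t t) (ℕₚ.∸-monoʳ-< (ℕₚ.≰⇒> sd≰t) sd≤m′)

  laplacian-expansion : ∀ a b → a < n → b < n →
    (ℤ.+ m ℚ./ 2) * δ a b + - ½ * blockℕ 0ℚ one one (λ _ _ → 0ℚ) a b
      + ∑[ k < t ] (rawCoeff (suc k) * blockℕ 0ℚ zero' zero' (circℕ m (ck n (suc k))) a b)
    ≡ L a b
  laplacian-expansion zero zero _ _ = trans
    (cong₂ (λ x y → x * 1ℚ + - ½ * 0ℚ + y) (/-suc (ℤ.+ m) 1) (sum-zero t (λ k _ → ℚₚ.*-zeroʳ (rawCoeff (suc k)))))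
    (solve 1 (λ M → M :* con ½ :* con 1ℚ :+ con (- ½) :* con 0ℚ :+ con 0ℚ := M :* con ½) refl (fromℕ m))
  laplacian-expansion zero (suc q) _ _ = trans
    (cong (λ y → (ℤ.+ m ℚ./ 2) * 0ℚ + - ½ * 1ℚ + y) (sum-zero t (λ k _ → ℚₚ.*-zeroʳ (rawCoeff (suc k)))))
    (solve 1 (λ x → x :* con 0ℚ :+ con (- ½) :* con 1ℚ :+ con 0ℚ := con (- ½)) refl (ℤ.+ m ℚ./ 2))
  laplacian-expansion (suc p) zero _ _ = trans
    (cong (λ y → (ℤ.+ m ℚ./ 2) * 0ℚ + - ½ * 1ℚ + y) (sum-zero t (λ k _ → ℚₚ.*-zeroʳ (rawCoeff (suc k)))))
    (solve 1 (λ x → x :* con 0ℚ :+ con (- ½) :* con 1ℚ :+ con 0ℚ := con (- ½)) refl (ℤ.+ m ℚ./ 2))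
  laplacian-expansion (suc p) (suc q) (s≤s p<m) (s≤s q<m) = begin
    (ℤ.+ m ℚ./ 2) * δ (suc p) (suc q) + - ½ * 0ℚ
      + ∑[ k < t ] (rawCoeff (suc k) * ck n (suc k) ((q ℕ.+ m ℕ.∸ p) mod m))
      ≡⟨ cong₂ (λ x y → x + - ½ * 0ℚ + y)
           (cong₂ _*_ (/-suc (ℤ.+ m) 1) (trans (δ-suc p q) (trans (δ-sym p q) (sym (δ-offset-0 p q p<m q<m)))))
           (sum-cong t (λ k k<t → cong₂ _*_ (rawCoeff≡coeff (suc k) (2[1+k]≤m k<t)) (cong (ck n (suc k)) (circ-offset p q p<m q<m)))) ⟩
    fromℕ m * ½ * δ (offset p q) 0 + - ½ * 0ℚ + ∑[ k < t ] (coeff (suc k) * ck n (suc k) (offset p q))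
      ≡⟨ cong (_+ ∑[ k < t ] (coeff (suc k) * ck n (suc k) (offset p q))) (solve 1 (λ x → x :+ con (- ½) :* con 0ℚ := x) refl (fromℕ m * ½ * δ (offset p q) 0)) ⟩
    fromℕ m * ½ * δ (offset p q) 0 + ∑[ k < t ] (coeff (suc k) * ck n (suc k) (offset p q))
      ≡⟨ laplacian-cycle-entry (offset p q) (offset<m p q p<m q<m) ⟩
    coeff (offset p q) ∎
    where
    open ≡-Reasoning
    2[1+k]≤m : ∀ {k} → k < t → 2 ℕ.* suc k ≤ m
    2[1+k]≤m {k} k<t = ℕₚ.≤-trans (subst (_≤ m′) (cong (suc k ℕ.+_) (sym (ℕₚ.+-identityʳ (suc k)))) (ℕₚ.+-mono-≤ k<t k<t))
                                   (ℕₚ.n≤1+n m′)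

  wheelD≡D : ∀ i j → wheelD n i j ≡ D (toℕ i) (toℕ j)
  wheelD≡D i j = blockℕ-cong (λ p q p<m q<m → cong (distRow m) (circ-offset p q p<m q<m)) (toℕ i) (toℕ j) (toℕ<n i) (toℕ<n j)

  specialL≡L : ∀ i j → specialL n i j ≡ L (toℕ i) (toℕ j)
  specialL≡L i j = trans
    (cong₂ (λ x y → (ℤ.+ m ℚ./ 2) * x + - ½ * blockℕ 0ℚ one one (λ _ _ → 0ℚ) (toℕ i) (toℕ j) + y) (Id≡δ i j)
      (trans (cong (λ u → sumM (map term (map suc (upTo u))) i j) n/2∸1≡t) (sumM-applyUpTo term (λ k → k) t i j)))
    (laplacian-expansion (toℕ i) (toℕ j) (toℕ<n i) (toℕ<n j))
    where
    term : ℕ → Matrix n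
    term k = rawCoeff k · Ckblock n k
    n/2∸1≡t : n ℕ./ 2 ℕ.∸ 1 ≡ t
    n/2∸1≡t = cong (ℕ._∸ 1) (trans (cong (ℕ._/ 2) n≡[1+t]*2) (m*n/n≡m (suc t) 2))
      where
      n≡[1+t]*2 : n ≡ suc t ℕ.* 2
      n≡[1+t]*2 = cong (λ z → suc (suc z)) (trans (cong (t ℕ.+_) (sym (ℕₚ.+-identityʳ t))) (ℕₚ.*-comm 2 t))

  wvec≡w : ∀ i → wvec n i ≡ w (toℕ i)
  wvec≡w i with toℕ i
  ... | suc _ = refl
  ... | zero  = begin
    (ℤ.+ 5 ℤ.- ℤ.+ n) ℚ./ 4                  ≡⟨ /-suc (ℤ.+ 5 ℤ.- ℤ.+ n) 3 ⟩
    fromℤ (ℤ.+ 5 ℤ.- ℤ.+ n) * ¼              ≡⟨ cong (_* ¼) (trans (fromℤ-+ (ℤ.+ 5) (ℤ.- ℤ.+ n)) (cong (fromℕ 5 +_) (fromℤ-neg (ℤ.+ n)))) ⟩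
    (fromℕ 5 + - fromℕ (suc m)) * ¼          ≡⟨ cong (λ x → (fromℕ 5 + - x) * ¼) (fromℕ-+ 1 m) ⟩
    (fromℕ 5 + - (1ℚ + fromℕ m)) * ¼         ≡⟨ solve 1 (λ M → (con (fromℕ 5) :+ (:- (con 1ℚ :+ M))) :* con ¼ := (con (fromℕ 4) :- M) :* con ¼) refl (fromℕ m) ⟩
    (fromℕ 4 - fromℕ m) * ¼                  ∎
    where open ≡-Reasoning

  claimedInverse≡C : ∀ i j → claimedInverse n i j ≡ C (toℕ i) (toℕ j)
  claimedInverse≡C i j = cong₂ (λ x y → - ½ * x + (ℤ.+ 4 ℚ./ m) * y) (specialL≡L i j) (cong₂ _*_ (wvec≡w i) (wvec≡w j))

  D-hub-row : ∀ (X : ℕ → ℚ) → ∑[ k < n ] (D 0 k * X k) ≡ ∑[ q < m ] X (suc q)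
  D-hub-row X = trans (cong₂ _+_ (ℚₚ.*-zeroˡ (X 0)) (sum-cong m (λ q _ → ℚₚ.*-identityˡ (X (suc q))))) (ℚₚ.+-identityˡ _)

  D-cycle-row : ∀ p (X : ℕ → ℚ) → p < m → ∑[ k < n ] (D (suc p) k * X k)
    ≡ X 0 + fromℕ 2 * ∑[ q < m ] X (suc q) - (fromℕ 2 * X (suc p) + X (suc (next p)) + X (suc (prev p)))
  D-cycle-row p X p<m = begin
    1ℚ * X 0 + ∑[ q < m ] (distRow m (offset p q) * X (suc q))
      ≡⟨ cong₂ _+_ (ℚₚ.*-identityˡ (X 0)) (∑-distRow-offset p (λ q → X (suc q)) p<m) ⟩
    X 0 + (fromℕ 2 * S - fromℕ 2 * X (suc p) - X (suc (next p)) - X (suc (prev p)))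
      ≡⟨ solve 5 (λ x₀ s a b c → x₀ :+ (con (fromℕ 2) :* s :- con (fromℕ 2) :* a :- b :- c)
                              := x₀ :+ con (fromℕ 2) :* s :- (con (fromℕ 2) :* a :+ b :+ c))
           refl (X 0) S (X (suc p)) (X (suc (next p))) (X (suc (prev p))) ⟩
    X 0 + fromℕ 2 * S - (fromℕ 2 * X (suc p) + X (suc (next p)) + X (suc (prev p))) ∎
    where
    open ≡-Reasoning
    S = ∑[ q < m ] X (suc q)

  coeff-offset-sym : ∀ p q → p < m → q < m → coeff (offset p q) ≡ coeff (offset q p)
  coeff-offset-sym p q p<m q<m with p ≟ q
  ... | yes refl = refl
  ... | no  p≢q  = coeff-reflect (offset p q) (offset q p)
                     (trans (cong (offset p q ℕ.+_) (offset-swap p q p<m q<m p≢q)) (ℕₚ.m+[n∸m]≡n (ℕₚ.<⇒≤ (offset<m p q p<m q<m))))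

  coeff-next : ∀ x → x < m → coeff (next x) ≡ coeff (suc x)
  coeff-next x x<m with suc x ≟ m
  ... | yes sx≡m = trans (coeff-reflect 0 m refl) (cong coeff (sym sx≡m))
  ... | no  _    = refl

  laplacian-recurrence : ∀ x → x < m → fromℕ 2 * coeff x + coeff (prev x) + coeff (next x) ≡ fromℕ 2 * δ x 0
  laplacian-recurrence zero    0<m = begin
    fromℕ 2 * coeff 0 + coeff m′ + coeff (next 0)  ≡⟨ cong₂ (λ a b → fromℕ 2 * coeff 0 + a + b)
                                                          (coeff-reflect m′ 1 (ℕₚ.+-comm m′ 1)) (coeff-next 0 0<m) ⟩
    fromℕ 2 * coeff 0 + coeff 1 + coeff 1          ≡⟨ coeff-base ⟩
    fromℕ 2 * 1ℚ                                   ∎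
    where open ≡-Reasoning
  laplacian-recurrence (suc y) sy<m = begin
    fromℕ 2 * coeff (suc y) + coeff y + coeff (next (suc y))  ≡⟨ cong (fromℕ 2 * coeff (suc y) + coeff y +_) (coeff-next (suc y) sy<m) ⟩
    fromℕ 2 * coeff (suc y) + coeff y + coeff (suc (suc y))   ≡⟨ coeff-recurrence y ⟩
    0ℚ                                                        ≡⟨ sym (ℚₚ.*-zeroʳ (fromℕ 2)) ⟩
    fromℕ 2 * 0ℚ                                              ∎
    where open ≡-Reasoning

  L-neighbours : ∀ p q → p < m → q < m →
    fromℕ 2 * L (suc p) (suc q) + L (suc (next p)) (suc q) + L (suc (prev p)) (suc q) ≡ fromℕ 2 * δ p q
  L-neighbours p q p<m q<m = begin
    fromℕ 2 * coeff x + coeff (offset (next p) q) + coeff (offset (prev p) q)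
      ≡⟨ cong₂ (λ a b → fromℕ 2 * coeff x + coeff a + coeff b) (offset-next p q p<m q<m) (offset-prev p q p<m q<m) ⟩
    fromℕ 2 * coeff x + coeff (prev x) + coeff (next x)
      ≡⟨ laplacian-recurrence x (offset<m p q p<m q<m) ⟩
    fromℕ 2 * δ x 0
      ≡⟨ cong (fromℕ 2 *_) (trans (δ-offset-0 p q p<m q<m) (δ-sym q p)) ⟩
    fromℕ 2 * δ p q ∎
    where
    open ≡-Reasoning
    x = offset p q

  L-hub-column : ∑[ p < m ] L (suc p) 0 ≡ fromℕ m * - ½
  L-hub-column = sum-const m (- ½)

  L-cycle-column : ∀ q → q < m → ∑[ p < m ] L (suc p) (suc q) ≡ ½
  L-cycle-column q q<m = begin
    ∑[ p < m ] coeff (offset p q)   ≡⟨ sum-cong m (λ p p<m → coeff-offset-sym p q p<m q<m) ⟩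
    ∑[ p < m ] coeff (offset q p)   ≡⟨ ∑-offset q coeff q<m ⟩
    sum m coeff                     ≡⟨ ∑-coeff-m ⟩
    ½                               ∎
    where open ≡-Reasoning

  D*L : ∀ a b → a < n → b < n → ∑[ k < n ] (D a k * L k b) ≡ fromℕ 2 * w b - fromℕ 2 * δ a b
  D*L zero zero _ _ = begin
    ∑[ k < n ] (D 0 k * L k 0)        ≡⟨ trans (D-hub-row (λ k → L k 0)) L-hub-column ⟩
    fromℕ m * - ½                     ≡⟨ solve 1 (λ M → M :* (:- con ½) := con (fromℕ 2) :* ((con (fromℕ 4) :- M) :* con ¼) :- con (fromℕ 2) :* con 1ℚ)
                                           refl (fromℕ m) ⟩
    fromℕ 2 * w 0 - fromℕ 2 * 1ℚ     ∎
    where open ≡-Reasoning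
  D*L zero (suc q) _ (s≤s q<m) = trans (D-hub-row (λ k → L k (suc q))) (L-cycle-column q q<m)
  D*L (suc p) zero (s≤s p<m) _ = begin
    ∑[ k < n ] (D (suc p) k * L k 0)
      ≡⟨ D-cycle-row p (λ k → L k 0) p<m ⟩
    fromℕ m * ½ + fromℕ 2 * ∑[ q < m ] L (suc q) 0 - (fromℕ 2 * - ½ + - ½ + - ½)
      ≡⟨ cong (λ s → fromℕ m * ½ + fromℕ 2 * s - (fromℕ 2 * - ½ + - ½ + - ½)) L-hub-column ⟩
    fromℕ m * ½ + fromℕ 2 * (fromℕ m * - ½) - (fromℕ 2 * - ½ + - ½ + - ½)
      ≡⟨ solve 1 (λ M → M :* con ½ :+ con (fromℕ 2) :* (M :* (:- con ½)) :- (con (fromℕ 2) :* (:- con ½) :+ (:- con ½) :+ (:- con ½))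
                      := con (fromℕ 2) :* ((con (fromℕ 4) :- M) :* con ¼) :- con (fromℕ 2) :* con 0ℚ) refl (fromℕ m) ⟩
    fromℕ 2 * w 0 - fromℕ 2 * 0ℚ ∎
    where open ≡-Reasoning
  D*L (suc p) (suc q) (s≤s p<m) (s≤s q<m) = begin
    ∑[ k < n ] (D (suc p) k * L k (suc q))
      ≡⟨ D-cycle-row p (λ k → L k (suc q)) p<m ⟩
    - ½ + fromℕ 2 * ∑[ r < m ] L (suc r) (suc q) - (fromℕ 2 * L (suc p) (suc q) + L (suc (next p)) (suc q) + L (suc (prev p)) (suc q))
      ≡⟨ cong₂ (λ s l → - ½ + fromℕ 2 * s - l) (L-cycle-column q q<m) (L-neighbours p q p<m q<m) ⟩
    - ½ + fromℕ 2 * ½ - fromℕ 2 * δ p q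
      ≡⟨⟩
    fromℕ 2 * ¼ - fromℕ 2 * δ p q
      ≡⟨ cong (λ d → fromℕ 2 * ¼ - fromℕ 2 * d) (sym (δ-suc p q)) ⟩
    fromℕ 2 * ¼ - fromℕ 2 * δ (suc p) (suc q) ∎
    where open ≡-Reasoning

  D*w : ∀ a → a < n → ∑[ k < n ] (D a k * w k) ≡ fromℕ m * ¼
  D*w zero    _         = trans (D-hub-row w) (sum-const m ¼)
  D*w (suc p) (s≤s p<m) = begin
    ∑[ k < n ] (D (suc p) k * w k)
      ≡⟨ D-cycle-row p w p<m ⟩
    (fromℕ 4 - fromℕ m) * ¼ + fromℕ 2 * ∑[ q < m ] ¼ - (fromℕ 2 * ¼ + ¼ + ¼)
      ≡⟨ cong (λ s → (fromℕ 4 - fromℕ m) * ¼ + fromℕ 2 * s - (fromℕ 2 * ¼ + ¼ + ¼)) (sum-const m ¼) ⟩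
    (fromℕ 4 - fromℕ m) * ¼ + fromℕ 2 * (fromℕ m * ¼) - (fromℕ 2 * ¼ + ¼ + ¼)
      ≡⟨ solve 1 (λ M → (con (fromℕ 4) :- M) :* con ¼ :+ con (fromℕ 2) :* (M :* con ¼) :- (con (fromℕ 2) :* con ¼ :+ con ¼ :+ con ¼)
                      := M :* con ¼) refl (fromℕ m) ⟩
    fromℕ m * ¼ ∎
    where open ≡-Reasoning

  4/m*m/4 : (ℤ.+ 4 ℚ./ m) * (fromℕ m * ¼) ≡ 1ℚ
  4/m*m/4 = begin
    (ℤ.+ 4 ℚ./ m) * (fromℕ m * ¼)          ≡⟨ cong (_* (fromℕ m * ¼)) (/-suc (ℤ.+ 4) m′) ⟩
    fromℕ 4 * 1/m * (fromℕ m * ¼)          ≡⟨ solve 2 (λ M r → con (fromℕ 4) :* r :* (M :* con ¼) := M :* r :* (con (fromℕ 4) :* con ¼))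
                                                 refl (fromℕ m) 1/m ⟩
    fromℕ m * 1/m * (fromℕ 4 * ¼)          ≡⟨ cong (_* (fromℕ 4 * ¼)) (fromℕ-*-1/ m′) ⟩
    1ℚ * (fromℕ 4 * ¼)                     ≡⟨⟩
    1ℚ                                     ∎
    where
    open ≡-Reasoning
    1/m = ℤ.+ 1 ℚ./ m

  D*C : ∀ a b → a < n → b < n → ∑[ k < n ] (D a k * C k b) ≡ δ a b
  D*C a b a<n b<n = begin
    ∑[ k < n ] (D a k * C k b)
      ≡⟨ sum-cong n (λ k _ → solve 6 (λ d l h c wk wb → d :* (h :* l :+ c :* (wk :* wb)) := h :* (d :* l) :+ c :* wb :* (d :* wk))
                                     refl (D a k) (L k b) (- ½) 4/m (w k) (w b)) ⟩
    ∑[ k < n ] (- ½ * (D a k * L k b) + 4/m * w b * (D a k * w k))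
      ≡⟨ ∑-distrib-+ n (λ k → - ½ * (D a k * L k b)) (λ k → 4/m * w b * (D a k * w k)) ⟩
    ∑[ k < n ] (- ½ * (D a k * L k b)) + ∑[ k < n ] (4/m * w b * (D a k * w k))
      ≡⟨ cong₂ _+_ (trans (∑-distribˡ-* n (- ½) (λ k → D a k * L k b)) (cong (- ½ *_) (D*L a b a<n b<n)))
                   (trans (∑-distribˡ-* n (4/m * w b) (λ k → D a k * w k)) (cong (4/m * w b *_) (D*w a a<n))) ⟩
    - ½ * (fromℕ 2 * w b - fromℕ 2 * δ a b) + 4/m * w b * (fromℕ m * ¼)
      ≡⟨ solve 4 (λ wb d c x → con (- ½) :* (con (fromℕ 2) :* wb :- con (fromℕ 2) :* d) :+ c :* wb :* x := d :+ wb :* (c :* x :- con 1ℚ))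
           refl (w b) (δ a b) 4/m (fromℕ m * ¼) ⟩
    δ a b + w b * (4/m * (fromℕ m * ¼) - 1ℚ)
      ≡⟨ cong (λ x → δ a b + w b * (x - 1ℚ)) 4/m*m/4 ⟩
    δ a b + w b * (1ℚ - 1ℚ)
      ≡⟨ solve 2 (λ d x → d :+ x :* (con 1ℚ :- con 1ℚ) := d) refl (δ a b) (w b) ⟩
    δ a b ∎
    where
    open ≡-Reasoning
    4/m = ℤ.+ 4 ℚ./ m

  L-sym : ∀ a b → a < n → b < n → L a b ≡ L b a
  L-sym zero    zero    _         _         = refl
  L-sym zero    (suc q) _         _         = refl
  L-sym (suc p) zero    _         _         = refl
  L-sym (suc p) (suc q) (s≤s p<m) (s≤s q<m) = coeff-offset-sym p q p<m q<m

  D-sym : ∀ a b → a < n → b < n → D a b ≡ D b a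
  D-sym zero    zero    _         _         = refl
  D-sym zero    (suc q) _         _         = refl
  D-sym (suc p) zero    _         _         = refl
  D-sym (suc p) (suc q) (s≤s p<m) (s≤s q<m) = distRow-offset-sym p q p<m q<m

  C-sym : ∀ a b → a < n → b < n → C a b ≡ C b a
  C-sym a b a<n b<n = cong₂ (λ x y → - ½ * x + (ℤ.+ 4 ℚ./ m) * y) (L-sym a b a<n b<n) (ℚₚ.*-comm (w a) (w b))

  C*D : ∀ a b → a < n → b < n → ∑[ k < n ] (C a k * D k b) ≡ δ a b
  C*D a b a<n b<n = begin
    ∑[ k < n ] (C a k * D k b)  ≡⟨ sum-cong n (λ k k<n → trans (cong₂ _*_ (C-sym a k a<n k<n) (D-sym k b k<n b<n)) (ℚₚ.*-comm (C k a) (D b k))) ⟩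
    ∑[ k < n ] (D b k * C k a)  ≡⟨ D*C b a b<n a<n ⟩
    δ b a                       ≡⟨ δ-sym b a ⟩
    δ a b                       ∎
    where open ≡-Reasoning

  inverse : (∀ i j → (wheelD n ⊗ claimedInverse n) i j ≡ Id i j) × (∀ i j → (claimedInverse n ⊗ wheelD n) i j ≡ Id i j)
  inverse = (λ i j → trans (⊗-toℕ D C wheelD≡D claimedInverse≡C i j) (trans (D*C (toℕ i) (toℕ j) (toℕ<n i) (toℕ<n j)) (sym (Id≡δ i j))))
          , (λ i j → trans (⊗-toℕ C D claimedInverse≡C wheelD≡D i j) (trans (C*D (toℕ i) (toℕ j) (toℕ<n i) (toℕ<n j)) (sym (Id≡δ i j))))

even≥4⇒2+t+t : ∀ {n} → 4 ≤ n → 2 ∣ n → Σ ℕ (λ t → 1 ≤ t × n ≡ suc (suc (t ℕ.+ t)))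
even≥4⇒2+t+t 4≤n (divides zero n≡0) with subst (4 ≤_) n≡0 4≤n
... | ()
even≥4⇒2+t+t 4≤n (divides (suc zero) n≡2) with subst (4 ≤_) n≡2 4≤n
... | s≤s (s≤s ())
even≥4⇒2+t+t _ (divides (suc (suc s)) n≡q*2) =
  suc s , s≤s z≤n , trans n≡q*2 (cong (λ z → suc (suc z)) (trans (ℕₚ.*-comm (suc s) 2) (cong (suc s ℕ.+_) (ℕₚ.+-identityʳ (suc s)))))

theorem1 : (n : ℕ) → 4 ≤ n → 2 ∣ n →
    (∀ i j → (wheelD n ⊗ claimedInverse n) i j ≡ Id i j)
    × (∀ i j → (claimedInverse n ⊗ wheelD n) i j ≡ Id i j)
theorem1 n 4≤n 2∣n with even≥4⇒2+t+t 4≤n 2∣n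
... | t , 1≤t , refl = Wheel.inverse t 1≤t
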